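{- Let $p$ be a prime, $l\ge 1$ an integer, and $j$ an integer. Then the polynomial $\prod_{i=0}^{p^l-1}(ix-i+j)$, reduced modulo $p^l$ as a polynomial in $x$, depends only on the residue class of $j$ modulo $p$; that is, for every integer $m$, $\prod_{i=0}^{p^l-1}(ix-i+j)\equiv\prod_{i=0}^{p^l-1}(ix-i+j+mp)\pmod{p^l}$ coefficientwise. -}

module Defs where

open import Data.Nat as ℕ using (ℕ; zero; suc)
open import Data.Integer using (ℤ; +_; _+_; _*_; _-_; 0ℤ)
open import Data.Integer.Divisibility using (_∣_)
open import Data.List using (List; []; _∷_)

-- Polynomials in one variable x with integer coefficients,
-- represented by coefficient lists, lowest degree first.
Poly : Set
Poly = List ℤ

_⊕_ : Poly → Poly → Poly
[] ⊕ q = q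
(a ∷ p) ⊕ [] = a ∷ p
(a ∷ p) ⊕ (b ∷ q) = (a + b) ∷ (p ⊕ q)

scale : ℤ → Poly → Poly
scale c [] = []
scale c (a ∷ p) = (c * a) ∷ scale c p

_⊗_ : Poly → Poly → Poly
[] ⊗ q = []
(a ∷ p) ⊗ q = scale a q ⊕ (0ℤ ∷ (p ⊗ q))

coeff : ℕ → Poly → ℤ
coeff k [] = 0ℤ
coeff zero (a ∷ p) = a
coeff (suc k) (a ∷ p) = coeff k p

-- The linear polynomial  i·x − i + j  =  (j − i) + i·x.
linFactor : ℤ → ℕ → Poly
linFactor j i = (j - + i) ∷ (+ i ∷ [])

prodFactors : ℤ → ℕ → Poly
prodFactors j zero = 1ℤ' ∷ []
  where 1ℤ' = + 1
prodFactors j (suc n) = prodFactors j n ⊗ linFactor j n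

_≡ₚ_[mod_] : Poly → Poly → ℕ → Set
P ≡ₚ Q [mod N ] = ∀ (k : ℕ) → (+ N) ∣ (coeff k P - coeff k Q)

{-# OPTIONS --safe #-}
module Submission where

-- Write Fₙ(a) = ∏_{i<n} (a + i·b) in an arbitrary commutative semiring; the polynomial of the
-- theorem is Fₙ(j) with b = x − 1, and we show Fₙ(a + p·c) ≡ Fₙ(a) (mod n) for n = pˡ by
-- induction on l.  For l = 1 this holds factor by factor.  For the step from N to pN, cut F_{pN}(a)
-- into the p blocks F_N(a + tN·b).  Telescoping gives F_N(a + tN·b) = F_N(a) + N·β_t(a) with β_t a
-- polynomial expression in a, hence, to first order,
--     F_{pN}(a) ≡ F_N(a)ᵖ + N·F_N(a)ᵖ⁻¹·Σ_t β_t(a)   (mod N²).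
-- Replacing a by a + p·c changes F_N(a) by a multiple of N (induction hypothesis), so F_N(a)ᵖ by a
-- multiple of pN because p ∣ N; it changes F_N(a) and every β_t(a) by multiples of p, so the
-- second term by a multiple of pN as well; and N² is a multiple of pN.

open import Algebra.Bundles using (CommutativeSemiring)

module RisingFactorial {c ℓ} (R : CommutativeSemiring c ℓ) where

  open import Level using (_⊔_)
  open import Data.Nat as ℕ using (ℕ; zero; suc; pred)
  import Data.Nat.Properties as ℕ
  open import Data.Nat.Divisibility using (_∣_; divides; *-monoˡ-∣; ∣-reflexive; m∣m*n)
  open import Relation.Binary.Bundles using (Preorder)
  import Relation.Binary.PropositionalEquality as ≡
  import Relation.Binary.Reasoning.Preorder
  import Relation.Binary.Reasoning.Setoid

  open CommutativeSemiring R
  open import Algebra.Definitions.RawSemiring rawSemiring using (_×_; _^_)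
  open import Algebra.Properties.Monoid.Mult +-monoid using (×-homo-+)
  open import Algebra.Properties.Semiring.Mult semiring using (×1-homo-*)
  open import Algebra.Solver.Ring.NaturalCoefficients.Default R

  private module ≈-Reasoning = Relation.Binary.Reasoning.Setoid setoid

  fromℕ : ℕ → Carrier
  fromℕ n = n × 1#

  ∏ : ℕ → (ℕ → Carrier) → Carrier
  ∏ zero    f = 1#
  ∏ (suc n) f = ∏ n f * f n

  ∑ : ℕ → (ℕ → Carrier) → Carrier
  ∑ zero    f = 0#
  ∑ (suc n) f = ∑ n f + f n

  syntax ∏ n (λ i → e) = ∏[ i < n ] e
  syntax ∑ n (λ i → e) = ∑[ i < n ] e

  ∏-cong : ∀ n {f g} → (∀ i → f i ≈ g i) → ∏ n f ≈ ∏ n g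
  ∏-cong zero    f≈g = refl
  ∏-cong (suc n) f≈g = *-cong (∏-cong n f≈g) (f≈g n)

  ∏-+ : ∀ m n f → ∏ (m ℕ.+ n) f ≈ ∏ m f * ∏[ i < n ] f (m ℕ.+ i)
  ∏-+ m zero    f = begin
    ∏ (m ℕ.+ 0) f  ≡⟨ ≡.cong (λ k → ∏ k f) (ℕ.+-identityʳ m) ⟩
    ∏ m f          ≈⟨ *-identityʳ (∏ m f) ⟨
    ∏ m f * 1#     ∎
    where open ≈-Reasoning
  ∏-+ m (suc n) f = begin
    ∏ (m ℕ.+ suc n) f                               ≡⟨ ≡.cong (λ k → ∏ k f) (ℕ.+-suc m n) ⟩
    ∏ (m ℕ.+ n) f * f (m ℕ.+ n)                     ≈⟨ *-congʳ (∏-+ m n f) ⟩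
    (∏ m f * ∏[ i < n ] f (m ℕ.+ i)) * f (m ℕ.+ n)  ≈⟨ *-assoc _ _ _ ⟩
    ∏ m f * (∏[ i < n ] f (m ℕ.+ i) * f (m ℕ.+ n))  ∎
    where open ≈-Reasoning

  ∏-blocks : ∀ q M f → ∏ (q ℕ.* M) f ≈ ∏[ t < q ] ∏[ i < M ] f (t ℕ.* M ℕ.+ i)
  ∏-blocks zero    M f = refl
  ∏-blocks (suc q) M f = begin
    ∏ (M ℕ.+ q ℕ.* M) f                           ≡⟨ ≡.cong (λ k → ∏ k f) (ℕ.+-comm M (q ℕ.* M)) ⟩
    ∏ (q ℕ.* M ℕ.+ M) f                           ≈⟨ ∏-+ (q ℕ.* M) M f ⟩
    ∏ (q ℕ.* M) f * ∏[ i < M ] f (q ℕ.* M ℕ.+ i)  ≈⟨ *-congʳ (∏-blocks q M f) ⟩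
    ∏[ t < q ] ∏[ i < M ] f (t ℕ.* M ℕ.+ i) * ∏[ i < M ] f (q ℕ.* M ℕ.+ i)  ∎
    where open ≈-Reasoning

  ∑-const : ∀ n x → ∑[ _ < n ] x ≈ fromℕ n * x
  ∑-const zero    x = sym (zeroˡ x)
  ∑-const (suc n) x = begin
    ∑[ _ < n ] x + x    ≈⟨ +-congʳ (∑-const n x) ⟩
    fromℕ n * x + x     ≈⟨ solve 2 (λ n x → n :* x :+ x := (con 1 :+ n) :* x) refl (fromℕ n) x ⟩
    (1# + fromℕ n) * x  ∎
    where open ≈-Reasoning

  -- Without subtraction, x ≡ y (mod m) is witnessed by x + m·left ≈ y + m·right.
  infix 4 _≈_[mod_]
  record _≈_[mod_] (x y : Carrier) (m : ℕ) : Set (c ⊔ ℓ) where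
    constructor congruent
    field
      left right : Carrier
      equation   : x + fromℕ m * left ≈ y + fromℕ m * right

  module _ {m : ℕ} where

    private
      M = fromℕ m

    ≈⇒mod : ∀ {x y} → x ≈ y → x ≈ y [mod m ]
    ≈⇒mod x≈y = congruent 0# 0# (+-congʳ x≈y)

    mod-refl : ∀ {x} → x ≈ x [mod m ]
    mod-refl = ≈⇒mod refl

    mod-sym : ∀ {x y} → x ≈ y [mod m ] → y ≈ x [mod m ]
    mod-sym (congruent z w x≈y) = congruent w z (sym x≈y)

    mod-trans : ∀ {x y u} → x ≈ y [mod m ] → y ≈ u [mod m ] → x ≈ u [mod m ]
    mod-trans {x} {y} {u} (congruent z w x≈y) (congruent z′ w′ y≈u) =
      congruent (z + z′) (w′ + w) (begin
        x + M * (z + z′)      ≈⟨ split x z z′ ⟩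
        (x + M * z) + M * z′  ≈⟨ +-congʳ x≈y ⟩
        (y + M * w) + M * z′  ≈⟨ swap y w z′ ⟩
        (y + M * z′) + M * w  ≈⟨ +-congʳ y≈u ⟩
        (u + M * w′) + M * w  ≈⟨ split u w′ w ⟨
        u + M * (w′ + w)      ∎)
      where
      open ≈-Reasoning
      split : ∀ x z z′ → x + M * (z + z′) ≈ (x + M * z) + M * z′
      split x z z′ = solve 4 (λ x M z z′ → x :+ M :* (z :+ z′) := (x :+ M :* z) :+ M :* z′)
                             refl x M z z′
      swap : ∀ y w z′ → (y + M * w) + M * z′ ≈ (y + M * z′) + M * w
      swap y w z′ = solve 4 (λ y M w z′ → (y :+ M :* w) :+ M :* z′ := (y :+ M :* z′) :+ M :* w)
                            refl y M w z′

    x+m*z≈x : ∀ x z → x + M * z ≈ x [mod m ]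
    x+m*z≈x x z = congruent 0# z (solve 3 (λ x M z → (x :+ M :* z) :+ M :* con 0 := x :+ M :* z) refl x M z)

    mod-+ : ∀ {x x′ y y′} → x ≈ x′ [mod m ] → y ≈ y′ [mod m ] → x + y ≈ x′ + y′ [mod m ]
    mod-+ {x} {x′} {y} {y′} (congruent z w x≈x′) (congruent z′ w′ y≈y′) =
      congruent (z + z′) (w + w′) (begin
        (x + y) + M * (z + z′)        ≈⟨ regroup x y z z′ ⟩
        (x + M * z) + (y + M * z′)    ≈⟨ +-cong x≈x′ y≈y′ ⟩
        (x′ + M * w) + (y′ + M * w′)  ≈⟨ regroup x′ y′ w w′ ⟨
        (x′ + y′) + M * (w + w′)      ∎)
      where
      open ≈-Reasoning
      regroup : ∀ x y z z′ → (x + y) + M * (z + z′) ≈ (x + M * z) + (y + M * z′)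
      regroup x y z z′ = solve 5 (λ x y M z z′ →
        (x :+ y) :+ M :* (z :+ z′) := (x :+ M :* z) :+ (y :+ M :* z′)) refl x y M z z′

    mod-* : ∀ {x x′ y y′} → x ≈ x′ [mod m ] → y ≈ y′ [mod m ] → x * y ≈ x′ * y′ [mod m ]
    mod-* {x} {x′} {y} {y′} (congruent z w x≈x′) (congruent z′ w′ y≈y′) =
      congruent (z * y + x * z′ + M * (z * z′)) (w * y′ + x′ * w′ + M * (w * w′)) (begin
        x * y + M * (z * y + x * z′ + M * (z * z′))      ≈⟨ expand x y z z′ ⟩
        (x + M * z) * (y + M * z′)                       ≈⟨ *-cong x≈x′ y≈y′ ⟩
        (x′ + M * w) * (y′ + M * w′)                     ≈⟨ expand x′ y′ w w′ ⟨
        x′ * y′ + M * (w * y′ + x′ * w′ + M * (w * w′))  ∎)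
      where
      open ≈-Reasoning
      expand : ∀ x y z z′ → x * y + M * (z * y + x * z′ + M * (z * z′)) ≈ (x + M * z) * (y + M * z′)
      expand x y z z′ = solve 5 (λ x y M z z′ →
        x :* y :+ M :* (z :* y :+ x :* z′ :+ M :* (z :* z′)) := (x :+ M :* z) :* (y :+ M :* z′))
        refl x y M z z′

    mod-^ : ∀ {x y} → x ≈ y [mod m ] → ∀ n → x ^ n ≈ y ^ n [mod m ]
    mod-^ x≈y zero    = mod-refl
    mod-^ x≈y (suc n) = mod-* x≈y (mod-^ x≈y n)

    mod-∏ : ∀ {f g} → (∀ i → f i ≈ g i [mod m ]) → ∀ n → ∏ n f ≈ ∏ n g [mod m ]
    mod-∏ f≈g zero    = mod-refl
    mod-∏ f≈g (suc n) = mod-* (mod-∏ f≈g n) (f≈g n)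

    mod-∑ : ∀ {f g} → (∀ i → f i ≈ g i [mod m ]) → ∀ n → ∑ n f ≈ ∑ n g [mod m ]
    mod-∑ f≈g zero    = mod-refl
    mod-∑ f≈g (suc n) = mod-+ (mod-∑ f≈g n) (f≈g n)

  mod-∣ : ∀ {m n x y} → m ∣ n → x ≈ y [mod n ] → x ≈ y [mod m ]
  mod-∣ {m} {x = x} {y} (divides q ≡.refl) (congruent z w x≈y) =
    congruent (fromℕ q * z) (fromℕ q * w) (begin
      x + fromℕ m * (fromℕ q * z)  ≈⟨ +-congˡ (regroup z) ⟩
      x + fromℕ (q ℕ.* m) * z      ≈⟨ x≈y ⟩
      y + fromℕ (q ℕ.* m) * w      ≈⟨ +-congˡ (regroup w) ⟨
      y + fromℕ m * (fromℕ q * w)  ∎)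
    where
    open ≈-Reasoning
    regroup : ∀ z → fromℕ m * (fromℕ q * z) ≈ fromℕ (q ℕ.* m) * z
    regroup z = trans (solve 3 (λ m q z → m :* (q :* z) := (q :* m) :* z) refl (fromℕ m) (fromℕ q) z)
                      (*-congʳ (sym (×1-homo-* q m)))

  mod-scale : ∀ {m n x y} → x ≈ y [mod m ] → fromℕ n * x ≈ fromℕ n * y [mod m ℕ.* n ]
  mod-scale {m} {n} {x} {y} (congruent z w x≈y) = congruent z w (begin
    fromℕ n * x + fromℕ (m ℕ.* n) * z  ≈⟨ factor x z ⟩
    fromℕ n * (x + fromℕ m * z)        ≈⟨ *-congˡ x≈y ⟩
    fromℕ n * (y + fromℕ m * w)        ≈⟨ factor y w ⟨
    fromℕ n * y + fromℕ (m ℕ.* n) * w  ∎)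
    where
    open ≈-Reasoning
    factor : ∀ x z → fromℕ n * x + fromℕ (m ℕ.* n) * z ≈ fromℕ n * (x + fromℕ m * z)
    factor x z = trans (+-congˡ (*-congʳ (×1-homo-* m n)))
      (solve 4 (λ N M x z → N :* x :+ (M :* N) :* z := N :* (x :+ M :* z)) refl (fromℕ n) (fromℕ m) x z)

  mod-preorder : ℕ → Preorder c ℓ (c ⊔ ℓ)
  mod-preorder m = record
    { _≲_        = λ x y → x ≈ y [mod m ]
    ; isPreorder = record { isEquivalence = isEquivalence ; reflexive = ≈⇒mod ; trans = mod-trans }
    }

  module ≈-mod-Reasoning (m : ℕ) = Relation.Binary.Reasoning.Preorder (mod-preorder m)

  ∏-first-order : ∀ n d F (γ : ℕ → Carrier) →
    ∏[ t < suc n ] (F + fromℕ d * γ t) ≈ F ^ suc n + fromℕ d * (F ^ n * ∑[ t < suc n ] γ t) [mod d ℕ.* d ]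
  ∏-first-order zero    d F γ = ≈⇒mod (solve 3 (λ F D g →
    con 1 :* (F :+ D :* g) := F :* con 1 :+ D :* (con 1 :* (con 0 :+ g))) refl F (fromℕ d) (γ 0))
  ∏-first-order (suc n) d F γ = begin
    ∏[ t < suc n ] (F + D * γ t) * (F + D * g)    ≲⟨ mod-* (∏-first-order n d F γ) mod-refl ⟩
    (F ^ suc n + D * (F ^ n * S)) * (F + D * g)   ≈⟨ expand ⟩
    F ^ suc (suc n) + D * (F ^ suc n * (S + g)) + fromℕ (d ℕ.* d) * (F ^ n * S * g)
                                                  ≲⟨ x+m*z≈x _ _ ⟩
    F ^ suc (suc n) + D * (F ^ suc n * (S + g))   ∎
    where
    open ≈-mod-Reasoning (d ℕ.* d)
    D = fromℕ d
    S = ∑[ t < suc n ] γ t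
    g = γ (suc n)
    expand : (F ^ suc n + D * (F ^ n * S)) * (F + D * g)
           ≈ F ^ suc (suc n) + D * (F ^ suc n * (S + g)) + fromℕ (d ℕ.* d) * (F ^ n * S * g)
    expand = trans (solve 5 (λ F Fⁿ D S g →
        (F :* Fⁿ :+ D :* (Fⁿ :* S)) :* (F :+ D :* g)
      := F :* (F :* Fⁿ) :+ D :* ((F :* Fⁿ) :* (S :+ g)) :+ (D :* D) :* (Fⁿ :* S :* g)) refl F (F ^ n) D S g)
      (+-congˡ (*-congʳ (sym (×1-homo-* d d))))

  -- (x + N·z)ᵖ ≡ xᵖ + pN·xᵖ⁻¹·z (mod N²), and N² is a multiple of pN.
  mod-^-lift : ∀ p N {x y} → suc p ∣ N → x ≈ y [mod N ] → x ^ suc p ≈ y ^ suc p [mod suc p ℕ.* N ]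
  mod-^-lift p N {x} {y} p∣N (congruent z w x≈y) = begin
    x ^ P                                     ≲⟨ mod-sym (x+m*z≈x _ _) ⟩
    x ^ P + fromℕ (P ℕ.* N) * (x ^ p * z)     ≈⟨ +-congˡ (linear-term x z) ⟩
    x ^ P + fromℕ N * (x ^ p * ∑[ _ < P ] z)  ≲⟨ mod-sym (weaken (∏-first-order p N x (λ _ → z))) ⟩
    ∏[ _ < P ] (x + fromℕ N * z)              ≈⟨ ∏-cong P (λ _ → x≈y) ⟩
    ∏[ _ < P ] (y + fromℕ N * w)              ≲⟨ weaken (∏-first-order p N y (λ _ → w)) ⟩
    y ^ P + fromℕ N * (y ^ p * ∑[ _ < P ] w)  ≈⟨ +-congˡ (linear-term y w) ⟨
    y ^ P + fromℕ (P ℕ.* N) * (y ^ p * w)     ≲⟨ x+m*z≈x _ _ ⟩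
    y ^ P                                     ∎
    where
    open ≈-mod-Reasoning (suc p ℕ.* N)
    P = suc p
    weaken : ∀ {u v} → u ≈ v [mod N ℕ.* N ] → u ≈ v [mod P ℕ.* N ]
    weaken = mod-∣ (*-monoˡ-∣ N p∣N)
    linear-term : ∀ x z → fromℕ (P ℕ.* N) * (x ^ p * z) ≈ fromℕ N * (x ^ p * ∑[ _ < P ] z)
    linear-term x z = trans (*-congʳ (×1-homo-* P N)) (trans
      (solve 4 (λ P N X z → (P :* N) :* (X :* z) := N :* (X :* (P :* z))) refl (fromℕ P) (fromℕ N) (x ^ p) z)
      (*-congˡ (*-congˡ (sym (∑-const P z)))))

  rising : Carrier → Carrier → ℕ → Carrier
  rising a b n = ∏[ i < n ] (a + fromℕ i * b)

  rising-cong : ∀ {a a′} b n → a ≈ a′ → rising a b n ≈ rising a′ b n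
  rising-cong b n a≈a′ = ∏-cong n (λ _ → +-congʳ a≈a′)

  rising-mod : ∀ {m a a′} b n → a ≈ a′ [mod m ] → rising a b n ≈ rising a′ b n [mod m ]
  rising-mod b n a≈a′ = mod-∏ (λ _ → mod-+ a≈a′ mod-refl) n

  rising-suc : ∀ a b n → rising a b (suc n) ≈ a * rising (a + b) b n
  rising-suc a b n = begin
    rising a b (1 ℕ.+ n)                                      ≈⟨ ∏-+ 1 n _ ⟩
    1# * (a + 0# * b) * ∏[ i < n ] (a + (1# + fromℕ i) * b)  ≈⟨ *-cong first-factor (∏-cong n shift) ⟩
    a * rising (a + b) b n                                    ∎
    where
    open ≈-Reasoning
    first-factor : 1# * (a + 0# * b) ≈ a
    first-factor = solve 2 (λ a b → con 1 :* (a :+ con 0 :* b) := a) refl a b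
    shift : ∀ i → a + (1# + fromℕ i) * b ≈ (a + b) + fromℕ i * b
    shift i = solve 3 (λ a b i → a :+ (con 1 :+ i) :* b := (a :+ b) :+ i :* b) refl a b (fromℕ i)

  rising-blocks : ∀ a b q M → rising a b (q ℕ.* M) ≈ ∏[ t < q ] rising (a + fromℕ (t ℕ.* M) * b) b M
  rising-blocks a b q M = trans (∏-blocks q M _) (∏-cong q (λ t → ∏-cong M (shift t)))
    where
    shift : ∀ t i → a + fromℕ (t ℕ.* M ℕ.+ i) * b ≈ (a + fromℕ (t ℕ.* M) * b) + fromℕ i * b
    shift t i = trans (+-congˡ (*-congʳ (×-homo-+ 1# (t ℕ.* M) i)))
      (solve 4 (λ a T I b → a :+ (T :+ I) :* b := (a :+ T :* b) :+ I :* b) refl a (fromℕ (t ℕ.* M)) (fromℕ i) b)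

  -- The two products share the factors a + i·b for 0 < i < n; they differ only in a + n·b against a.
  rising-shift : ∀ a b n → rising (a + b) b n ≈ rising a b n + fromℕ n * (b * rising (a + b) b (pred n))
  rising-shift a b zero    = solve 1 (λ b → con 1 := con 1 :+ con 0 :* (b :* con 1)) refl b
  rising-shift a b (suc n) = begin
    E * ((a + b) + fromℕ n * b)                   ≈⟨ telescope ⟩
    a * E + (1# + fromℕ n) * (b * E)              ≈⟨ +-congʳ (rising-suc a b n) ⟨
    rising a b (suc n) + fromℕ (suc n) * (b * E)  ∎
    where
    open ≈-Reasoning
    E = rising (a + b) b n
    telescope : E * ((a + b) + fromℕ n * b) ≈ a * E + (1# + fromℕ n) * (b * E)
    telescope = solve 4 (λ E a b n → E :* ((a :+ b) :+ n :* b) := a :* E :+ (con 1 :+ n) :* (b :* E))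
                        refl E a b (fromℕ n)

  shiftQuotient : Carrier → Carrier → ℕ → ℕ → Carrier
  shiftQuotient a b n u = ∑[ v < u ] (b * rising ((a + fromℕ v * b) + b) b (pred n))

  rising-shift-multiple : ∀ a b n u →
    rising (a + fromℕ u * b) b n ≈ rising a b n + fromℕ n * shiftQuotient a b n u
  rising-shift-multiple a b n zero    =
    trans (rising-cong b n (solve 2 (λ a b → a :+ con 0 :* b := a) refl a b))
          (solve 2 (λ r N → r := r :+ N :* con 0) refl (rising a b n) (fromℕ n))
  rising-shift-multiple a b n (suc u) = begin
    rising (a + (1# + fromℕ u) * b) b n                 ≈⟨ rising-cong b n step ⟩
    rising (aᵤ + b) b n                                 ≈⟨ rising-shift aᵤ b n ⟩
    rising aᵤ b n + N * g                               ≈⟨ +-congʳ (rising-shift-multiple a b n u) ⟩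
    (rising a b n + N * shiftQuotient a b n u) + N * g  ≈⟨ collect (rising a b n) (shiftQuotient a b n u) ⟩
    rising a b n + N * shiftQuotient a b n (suc u)      ∎
    where
    open ≈-Reasoning
    aᵤ = a + fromℕ u * b
    N  = fromℕ n
    g  = b * rising (aᵤ + b) b (pred n)
    step : a + (1# + fromℕ u) * b ≈ aᵤ + b
    step = solve 3 (λ a u b → a :+ (con 1 :+ u) :* b := (a :+ u :* b) :+ b) refl a (fromℕ u) b
    collect : ∀ r s → (r + N * s) + N * g ≈ r + N * (s + g)
    collect r s = solve 4 (λ r N s g → (r :+ N :* s) :+ N :* g := r :+ N :* (s :+ g)) refl r N s g

  blockQuotient : Carrier → Carrier → ℕ → ℕ → Carrier
  blockQuotient a b N q = ∑[ t < q ] shiftQuotient a b N (t ℕ.* N)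

  rising-blocks-first-order : ∀ a b N p → let F = rising a b N in
    rising a b (suc p ℕ.* N) ≈ F ^ suc p + fromℕ N * (F ^ p * blockQuotient a b N (suc p)) [mod N ℕ.* N ]
  rising-blocks-first-order a b N p = begin
    rising a b (suc p ℕ.* N)
      ≈⟨ rising-blocks a b (suc p) N ⟩
    ∏[ t < suc p ] rising (a + fromℕ (t ℕ.* N) * b) b N
      ≈⟨ ∏-cong (suc p) (λ t → rising-shift-multiple a b N (t ℕ.* N)) ⟩
    ∏[ t < suc p ] (rising a b N + fromℕ N * shiftQuotient a b N (t ℕ.* N))
      ≲⟨ ∏-first-order p N (rising a b N) _ ⟩
    rising a b N ^ suc p + fromℕ N * (rising a b N ^ p * blockQuotient a b N (suc p))
      ∎
    where open ≈-mod-Reasoning (N ℕ.* N)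

  blockQuotient-mod : ∀ {p} a b c N q → blockQuotient (a + fromℕ p * c) b N q ≈ blockQuotient a b N q [mod p ]
  blockQuotient-mod a b c N q = mod-∑ (λ t → mod-∑ (λ v → mod-* mod-refl
    (rising-mod b (pred N) (mod-+ (mod-+ (x+m*z≈x a c) mod-refl) mod-refl))) (t ℕ.* N)) q

  rising-shift-mod-step : ∀ p N b → p ∣ N →
    (∀ a c → rising (a + fromℕ p * c) b N ≈ rising a b N [mod N ]) →
    ∀ a c → rising (a + fromℕ p * c) b (p ℕ.* N) ≈ rising a b (p ℕ.* N) [mod p ℕ.* N ]
  rising-shift-mod-step zero    N b _   _          a c = mod-refl
  rising-shift-mod-step (suc p) N b p∣N shift-mod-N a c = begin
    rising a′ b (P ℕ.* N)             ≲⟨ weaken (rising-blocks-first-order a′ b N p) ⟩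
    F′ ^ P + fromℕ N * (F′ ^ p * B′)  ≲⟨ mod-+ (mod-^-lift p N p∣N F′≈F)
                                                 (mod-scale (mod-* F′ᵖ≈Fᵖ B′≈B)) ⟩
    F ^ P + fromℕ N * (F ^ p * B)     ≲⟨ mod-sym (weaken (rising-blocks-first-order a b N p)) ⟩
    rising a b (P ℕ.* N)              ∎
    where
    open ≈-mod-Reasoning (suc p ℕ.* N)
    P  = suc p
    a′ = a + fromℕ P * c
    F  = rising a b N
    F′ = rising a′ b N
    B  = blockQuotient a b N P
    B′ = blockQuotient a′ b N P
    F′≈F : F′ ≈ F [mod N ]
    F′≈F = shift-mod-N a c
    F′ᵖ≈Fᵖ : F′ ^ p ≈ F ^ p [mod P ]
    F′ᵖ≈Fᵖ = mod-^ (mod-∣ p∣N F′≈F) p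
    B′≈B : B′ ≈ B [mod P ]
    B′≈B = blockQuotient-mod a b c N P
    weaken : ∀ {u v} → u ≈ v [mod N ℕ.* N ] → u ≈ v [mod P ℕ.* N ]
    weaken = mod-∣ (*-monoˡ-∣ N p∣N)

  rising-shift-mod : ∀ p l a b c →
    rising (a + fromℕ p * c) b (p ℕ.^ suc l) ≈ rising a b (p ℕ.^ suc l) [mod p ℕ.^ suc l ]
  rising-shift-mod p zero    a b c =
    mod-∣ (∣-reflexive (ℕ.*-identityʳ p)) (rising-mod b (p ℕ.* 1) (x+m*z≈x a c))
  rising-shift-mod p (suc l) a b c =
    rising-shift-mod-step p (p ℕ.^ suc l) b (m∣m*n (p ℕ.^ l)) (λ a c → rising-shift-mod p l a b c) a c

open import Level using (0ℓ)
open import Algebra.Bundles using (CommutativeMonoid)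
open import Algebra.Structures.Biased using (IsCommutativeMonoidˡ; isCommutativeSemiringˡ)
open import Data.Nat using (ℕ; zero; suc; _^_; _≤_)
open import Data.Nat.Primality using (Prime)
open import Data.Integer using (ℤ; +_; _+_; _*_; _-_; 0ℤ; 1ℤ; -_)
import Data.Integer.Properties as ℤ
open import Data.Integer.Divisibility.Signed using (divides; ∣⇒∣ᵤ)
open import Data.Integer.Tactic.RingSolver using (solve-∀)
open import Data.List using ([]; _∷_)
open import Relation.Binary.PropositionalEquality as ≡ using (_≡_; refl; cong₂)
open import Relation.Binary.Structures using (IsEquivalence)
import Relation.Binary.Reasoning.Setoid
open import Defs

-- Coefficient lists are not canonical (trailing zeros), so polynomials are compared coefficientwise.
infix 4 _≈ₚ_
record _≈ₚ_ (P Q : Poly) : Set where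
  constructor coeffwise
  field coeff-≡ : ∀ k → coeff k P ≡ coeff k Q
open _≈ₚ_

open import Algebra.Definitions _≈ₚ_

≈ₚ-isEquivalence : IsEquivalence _≈ₚ_
≈ₚ-isEquivalence = record
  { refl  = coeffwise λ _ → refl
  ; sym   = λ P≈Q → coeffwise λ k → ≡.sym (coeff-≡ P≈Q k)
  ; trans = λ P≈Q Q≈R → coeffwise λ k → ≡.trans (coeff-≡ P≈Q k) (coeff-≡ Q≈R k)
  }

open IsEquivalence ≈ₚ-isEquivalence renaming (refl to ≈ₚ-refl; sym to ≈ₚ-sym; trans to ≈ₚ-trans)

∷-cong : ∀ {a b P Q} → a ≡ b → P ≈ₚ Q → a ∷ P ≈ₚ b ∷ Q
coeff-≡ (∷-cong a≡b P≈Q) zero    = a≡b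
coeff-≡ (∷-cong a≡b P≈Q) (suc k) = coeff-≡ P≈Q k

0∷[]≈[] : 0ℤ ∷ [] ≈ₚ []
coeff-≡ 0∷[]≈[] zero    = refl
coeff-≡ 0∷[]≈[] (suc k) = refl

coeff-⊕ : ∀ k P Q → coeff k (P ⊕ Q) ≡ coeff k P + coeff k Q
coeff-⊕ k       []      Q       = ≡.sym (ℤ.+-identityˡ _)
coeff-⊕ k       (a ∷ P) []      = ≡.sym (ℤ.+-identityʳ _)
coeff-⊕ zero    (a ∷ P) (b ∷ Q) = refl
coeff-⊕ (suc k) (a ∷ P) (b ∷ Q) = coeff-⊕ k P Q

coeff-scale : ∀ k c P → coeff k (scale c P) ≡ c * coeff k P
coeff-scale k       c []      = ≡.sym (ℤ.*-zeroʳ c)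
coeff-scale zero    c (a ∷ P) = refl
coeff-scale (suc k) c (a ∷ P) = coeff-scale k c P

⊕-cong : Congruent₂ _⊕_
coeff-≡ (⊕-cong {P} {P′} {Q} {Q′} P≈P′ Q≈Q′) k
  rewrite coeff-⊕ k P Q | coeff-⊕ k P′ Q′ = cong₂ _+_ (coeff-≡ P≈P′ k) (coeff-≡ Q≈Q′ k)

⊕-assoc : Associative _⊕_
coeff-≡ (⊕-assoc P Q R) k
  rewrite coeff-⊕ k (P ⊕ Q) R | coeff-⊕ k P Q | coeff-⊕ k P (Q ⊕ R) | coeff-⊕ k Q R
  = ℤ.+-assoc (coeff k P) (coeff k Q) (coeff k R)

⊕-comm : Commutative _⊕_
coeff-≡ (⊕-comm P Q) k rewrite coeff-⊕ k P Q | coeff-⊕ k Q P = ℤ.+-comm (coeff k P) (coeff k Q)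

⊕-commutativeMonoid : CommutativeMonoid 0ℓ 0ℓ
⊕-commutativeMonoid = record
  { isCommutativeMonoid = IsCommutativeMonoidˡ.isCommutativeMonoid record
    { isSemigroup = record
      { isMagma = record { isEquivalence = ≈ₚ-isEquivalence ; ∙-cong = ⊕-cong }
      ; assoc   = ⊕-assoc
      }
    ; identityˡ = λ _ → ≈ₚ-refl
    ; comm      = ⊕-comm
    }
  }

open CommutativeMonoid ⊕-commutativeMonoid using () renaming (identityʳ to ⊕-identityʳ)
open import Algebra.Properties.CommutativeSemigroup
  (CommutativeMonoid.commutativeSemigroup ⊕-commutativeMonoid) using (interchange; x∙yz≈y∙xz)
private
  module ≈ₚ-Reasoning = Relation.Binary.Reasoning.Setoid (CommutativeMonoid.setoid ⊕-commutativeMonoid)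

scale-cong : ∀ c {P Q} → P ≈ₚ Q → scale c P ≈ₚ scale c Q
coeff-≡ (scale-cong c {P} {Q} P≈Q) k
  rewrite coeff-scale k c P | coeff-scale k c Q = ≡.cong (c *_) (coeff-≡ P≈Q k)

scale-distribˡ : ∀ c P Q → scale c (P ⊕ Q) ≈ₚ scale c P ⊕ scale c Q
coeff-≡ (scale-distribˡ c P Q) k
  rewrite coeff-scale k c (P ⊕ Q) | coeff-⊕ k P Q | coeff-⊕ k (scale c P) (scale c Q)
        | coeff-scale k c P | coeff-scale k c Q = ℤ.*-distribˡ-+ c (coeff k P) (coeff k Q)

scale-distribʳ : ∀ c d P → scale (c + d) P ≈ₚ scale c P ⊕ scale d P
coeff-≡ (scale-distribʳ c d P) k
  rewrite coeff-scale k (c + d) P | coeff-⊕ k (scale c P) (scale d P)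
        | coeff-scale k c P | coeff-scale k d P = ℤ.*-distribʳ-+ (coeff k P) c d

scale-assoc : ∀ c d P → scale (c * d) P ≈ₚ scale c (scale d P)
coeff-≡ (scale-assoc c d P) k
  rewrite coeff-scale k (c * d) P | coeff-scale k c (scale d P) | coeff-scale k d P
  = ℤ.*-assoc c d (coeff k P)

scale-zero : ∀ P → scale 0ℤ P ≈ₚ []
coeff-≡ (scale-zero P) k rewrite coeff-scale k 0ℤ P = refl

scale-one : ∀ P → scale 1ℤ P ≈ₚ P
coeff-≡ (scale-one P) k rewrite coeff-scale k 1ℤ P = ℤ.*-identityˡ (coeff k P)

⊗-congʳ : ∀ P {Q Q′} → Q ≈ₚ Q′ → P ⊗ Q ≈ₚ P ⊗ Q′
⊗-congʳ []      Q≈Q′ = ≈ₚ-refl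
⊗-congʳ (a ∷ P) Q≈Q′ = ⊕-cong (scale-cong a Q≈Q′) (∷-cong refl (⊗-congʳ P Q≈Q′))

⊗-zeroʳ : ∀ P → P ⊗ [] ≈ₚ []
⊗-zeroʳ []      = ≈ₚ-refl
⊗-zeroʳ (a ∷ P) = ≈ₚ-trans (∷-cong refl (⊗-zeroʳ P)) 0∷[]≈[]

⊗-∷ʳ : ∀ P b Q → P ⊗ (b ∷ Q) ≈ₚ scale b P ⊕ (0ℤ ∷ P ⊗ Q)
⊗-∷ʳ []      b Q = ≈ₚ-sym 0∷[]≈[]
⊗-∷ʳ (a ∷ P) b Q = ∷-cong (cong₂ _+_ (ℤ.*-comm a b) refl) (begin
  scale a Q ⊕ (P ⊗ (b ∷ Q))                 ≈⟨ ⊕-cong ≈ₚ-refl (⊗-∷ʳ P b Q) ⟩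
  scale a Q ⊕ (scale b P ⊕ (0ℤ ∷ P ⊗ Q))     ≈⟨ x∙yz≈y∙xz (scale a Q) (scale b P) _ ⟩
  scale b P ⊕ (scale a Q ⊕ (0ℤ ∷ P ⊗ Q))     ∎)
  where open ≈ₚ-Reasoning

⊗-comm : Commutative _⊗_
⊗-comm []      Q = ≈ₚ-sym (⊗-zeroʳ Q)
⊗-comm (a ∷ P) Q = ≈ₚ-trans (⊕-cong ≈ₚ-refl (∷-cong refl (⊗-comm P Q))) (≈ₚ-sym (⊗-∷ʳ Q a P))

⊗-cong : Congruent₂ _⊗_
⊗-cong {P} {P′} {Q} {Q′} P≈P′ Q≈Q′ = begin
  P ⊗ Q    ≈⟨ ⊗-congʳ P Q≈Q′ ⟩
  P ⊗ Q′   ≈⟨ ⊗-comm P Q′ ⟩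
  Q′ ⊗ P   ≈⟨ ⊗-congʳ Q′ P≈P′ ⟩
  Q′ ⊗ P′  ≈⟨ ⊗-comm Q′ P′ ⟩
  P′ ⊗ Q′  ∎
  where open ≈ₚ-Reasoning

⊗-distribʳ : _⊗_ DistributesOverʳ _⊕_
⊗-distribʳ Q []      P′       = ≈ₚ-refl
⊗-distribʳ Q (a ∷ P) []       = ≈ₚ-sym (⊕-identityʳ _)
⊗-distribʳ Q (a ∷ P) (b ∷ P′) = begin
  scale (a + b) Q ⊕ (0ℤ ∷ (P ⊕ P′) ⊗ Q)
    ≈⟨ ⊕-cong (scale-distribʳ a b Q) (∷-cong refl (⊗-distribʳ Q P P′)) ⟩
  (scale a Q ⊕ scale b Q) ⊕ ((0ℤ ∷ P ⊗ Q) ⊕ (0ℤ ∷ P′ ⊗ Q))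
    ≈⟨ interchange (scale a Q) (scale b Q) _ _ ⟩
  (scale a Q ⊕ (0ℤ ∷ P ⊗ Q)) ⊕ (scale b Q ⊕ (0ℤ ∷ P′ ⊗ Q))
    ∎
  where open ≈ₚ-Reasoning

scale-⊗ : ∀ c P Q → scale c P ⊗ Q ≈ₚ scale c (P ⊗ Q)
scale-⊗ c []      Q = ≈ₚ-refl
scale-⊗ c (a ∷ P) Q = begin
  scale (c * a) Q ⊕ (0ℤ ∷ scale c P ⊗ Q)
    ≈⟨ ⊕-cong (scale-assoc c a Q) (∷-cong (≡.sym (ℤ.*-zeroʳ c)) (scale-⊗ c P Q)) ⟩
  scale c (scale a Q) ⊕ scale c (0ℤ ∷ P ⊗ Q)
    ≈⟨ scale-distribˡ c (scale a Q) _ ⟨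
  scale c (scale a Q ⊕ (0ℤ ∷ P ⊗ Q))
    ∎
  where open ≈ₚ-Reasoning

0∷-⊗ : ∀ P Q → (0ℤ ∷ P) ⊗ Q ≈ₚ 0ℤ ∷ P ⊗ Q
0∷-⊗ P Q = ⊕-cong (scale-zero Q) ≈ₚ-refl

⊗-assoc : Associative _⊗_
⊗-assoc []      Q R = ≈ₚ-refl
⊗-assoc (a ∷ P) Q R = begin
  (scale a Q ⊕ (0ℤ ∷ P ⊗ Q)) ⊗ R          ≈⟨ ⊗-distribʳ R (scale a Q) _ ⟩
  (scale a Q ⊗ R) ⊕ ((0ℤ ∷ P ⊗ Q) ⊗ R)    ≈⟨ ⊕-cong (scale-⊗ a Q R) (0∷-⊗ (P ⊗ Q) R) ⟩
  scale a (Q ⊗ R) ⊕ (0ℤ ∷ (P ⊗ Q) ⊗ R)    ≈⟨ ⊕-cong ≈ₚ-refl (∷-cong refl (⊗-assoc P Q R)) ⟩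
  scale a (Q ⊗ R) ⊕ (0ℤ ∷ P ⊗ (Q ⊗ R))    ∎
  where open ≈ₚ-Reasoning

𝟙 : Poly
𝟙 = 1ℤ ∷ []

⊗-identityˡ : LeftIdentity 𝟙 _⊗_
⊗-identityˡ P = begin
  scale 1ℤ P ⊕ (0ℤ ∷ [])  ≈⟨ ⊕-cong (scale-one P) 0∷[]≈[] ⟩
  P ⊕ []                  ≈⟨ ⊕-identityʳ P ⟩
  P                       ∎
  where open ≈ₚ-Reasoning

Poly-commutativeSemiring : CommutativeSemiring 0ℓ 0ℓ
Poly-commutativeSemiring = record
  { 0# = []
  ; 1# = 𝟙
  ; isCommutativeSemiring = isCommutativeSemiringˡ record
    { +-isCommutativeMonoid = CommutativeMonoid.isCommutativeMonoid ⊕-commutativeMonoid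
    ; *-isCommutativeMonoid = IsCommutativeMonoidˡ.isCommutativeMonoid record
      { isSemigroup = record
        { isMagma = record { isEquivalence = ≈ₚ-isEquivalence ; ∙-cong = ⊗-cong }
        ; assoc   = ⊗-assoc
        }
      ; identityˡ = ⊗-identityˡ
      ; comm      = ⊗-comm
      }
    ; distribʳ = ⊗-distribʳ
    ; zeroˡ    = λ _ → ≈ₚ-refl {[]}
    }
  }

open RisingFactorial Poly-commutativeSemiring
  using (fromℕ; rising; rising-cong; _≈_[mod_]; congruent; mod-sym; rising-shift-mod; module ≈-mod-Reasoning)

const : ℤ → Poly
const c = c ∷ []

x-1 : Poly
x-1 = - 1ℤ ∷ 1ℤ ∷ []

fromℕ≈const : ∀ n → fromℕ n ≈ₚ const (+ n)
fromℕ≈const zero    = ≈ₚ-sym 0∷[]≈[]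
fromℕ≈const (suc n) = ⊕-cong ≈ₚ-refl (fromℕ≈const n)

const-⊗ : ∀ c P → const c ⊗ P ≈ₚ scale c P
const-⊗ c P = ≈ₚ-trans (⊕-cong ≈ₚ-refl 0∷[]≈[]) (⊕-identityʳ (scale c P))

fromℕ-⊗ : ∀ n P → fromℕ n ⊗ P ≈ₚ scale (+ n) P
fromℕ-⊗ n P = ≈ₚ-trans (⊗-cong (fromℕ≈const n) ≈ₚ-refl) (const-⊗ (+ n) P)

linFactor-expand : ∀ j i → linFactor j i ≈ₚ const j ⊕ (fromℕ i ⊗ x-1)
linFactor-expand j i = ≈ₚ-sym (≈ₚ-trans (⊕-cong ≈ₚ-refl (fromℕ-⊗ i x-1))
  (∷-cong (≡.cong (λ x → j + x) (≡.trans (ℤ.*-comm (+ i) (- 1ℤ)) (ℤ.-1*i≡-i (+ i))))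
          (∷-cong (ℤ.*-identityʳ (+ i)) ≈ₚ-refl)))

prodFactors≈rising : ∀ j n → prodFactors j n ≈ₚ rising (const j) x-1 n
prodFactors≈rising j zero    = ≈ₚ-refl
prodFactors≈rising j (suc n) = ⊗-cong (prodFactors≈rising j n) (linFactor-expand j n)

const-shift : ∀ j m p → const (j + m * + p) ≈ₚ const j ⊕ (fromℕ p ⊗ const m)
const-shift j m p = ≈ₚ-sym (≈ₚ-trans (⊕-cong ≈ₚ-refl (fromℕ-⊗ p (const m)))
  (∷-cong (≡.cong (λ x → j + x) (ℤ.*-comm (+ p) m)) ≈ₚ-refl))

coeff-⊕-fromℕ-⊗ : ∀ k P n Z → coeff k (P ⊕ (fromℕ n ⊗ Z)) ≡ coeff k P + + n * coeff k Z
coeff-⊕-fromℕ-⊗ k P n Z = begin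
  coeff k (P ⊕ (fromℕ n ⊗ Z))             ≡⟨ coeff-⊕ k P _ ⟩
  coeff k P + coeff k (fromℕ n ⊗ Z)       ≡⟨ ≡.cong (λ x → coeff k P + x) (coeff-≡ (fromℕ-⊗ n Z) k) ⟩
  coeff k P + coeff k (scale (+ n) Z)     ≡⟨ ≡.cong (λ x → coeff k P + x) (coeff-scale k (+ n) Z) ⟩
  coeff k P + + n * coeff k Z             ∎
  where open ≡.≡-Reasoning

mod⇒≡ₚ : ∀ {P Q n} → P ≈ Q [mod n ] → P ≡ₚ Q [mod n ]
mod⇒≡ₚ {P} {Q} {n} (congruent Z W P≈Q) k = ∣⇒∣ᵤ (divides (w - z) (begin
  p - q                              ≡⟨ add-both p q (+ n) z ⟩
  (p + + n * z) - (q + + n * z)      ≡⟨ ≡.cong (λ x → x - (q + + n * z)) coefficient-k ⟩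
  (q + + n * w) - (q + + n * z)      ≡⟨ collect q (+ n) z w ⟩
  (w - z) * + n                      ∎))
  where
  open ≡.≡-Reasoning
  p = coeff k P
  q = coeff k Q
  z = coeff k Z
  w = coeff k W
  coefficient-k : p + + n * z ≡ q + + n * w
  coefficient-k = ≡.trans (≡.sym (coeff-⊕-fromℕ-⊗ k P n Z))
                          (≡.trans (coeff-≡ P≈Q k) (coeff-⊕-fromℕ-⊗ k Q n W))
  add-both : ∀ x y n u → x - y ≡ (x + n * u) - (y + n * u)
  add-both = solve-∀
  collect : ∀ y n u v → (y + n * v) - (y + n * u) ≡ (v - u) * n
  collect = solve-∀

mainTheorem11 : (p : ℕ) → Prime p → (l : ℕ) → 1 ≤ l → (j m : ℤ) →
    prodFactors j (p ^ l) ≡ₚ prodFactors (j + m * + p) (p ^ l) [mod p ^ l ]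
mainTheorem11 p _ (suc l) _ j m = mod⇒≡ₚ (begin
  prodFactors j N                                ≈⟨ prodFactors≈rising j N ⟩
  rising (const j) x-1 N                         ≲⟨ mod-sym (rising-shift-mod p l (const j) x-1 (const m)) ⟩
  rising (const j ⊕ (fromℕ p ⊗ const m)) x-1 N   ≈⟨ rising-cong x-1 N (const-shift j m p) ⟨
  rising (const (j + m * + p)) x-1 N             ≈⟨ prodFactors≈rising (j + m * + p) N ⟨
  prodFactors (j + m * + p) N                    ∎)
  where
  N = p ^ suc l
  open ≈-mod-Reasoning N
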